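{- For every real $x>1$, every integer $\ell\ge1$ and every integer $n\ge1$, $$\mathrm{S}^{\ell+n}(2^n x)\ge \frac{\mathrm{S}^{\ell}(x)}{2^n}.$$
   Context: $\phi$ is Euler's totient function, $\mathscr{V}$ its set of values, $\mathrm{A}(m)=|\phi^{ -1}(m)|$, $\mathscr{V}^{\ell}=\{m\in\mathscr{V}: m\equiv 2^{\ell}\pmod{2^{\ell+1}}\}$, and $\mathrm{S}^{\ell}(x)=\sum_{m\in\mathscr{V}^{\ell},\,m\le x}\mathrm{A}(m)$ (the number of positive integers $z$ with $\phi(z)\in\mathscr{V}^{\ell}$ and $\phi(z)\le x$).
   Formalization: The number x ranges over the rationals greater than 1 rather than over the reals greater than 1. -}

module Defs where

open import Data.Nat using (ℕ; suc; _≤_; _^_; _+_)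
open import Data.Nat.DivMod using (_%_)
open import Data.Nat.GCD using (gcd)
open import Data.List using (List; length; filter; upTo; map)
open import Data.Integer using (+_)
open import Data.Rational using (ℚ; _/_) renaming (_≤_ to _≤ℚ_)
open import Data.Product using (Σ; _×_)
open import Data.Fin using (Fin)
open import Function.Bundles using (_↔_)
open import Relation.Binary.PropositionalEquality using (_≡_)
open import Data.Nat.Properties using (_≟_; m^n≢0)

-- Euler's totient: φ z = #{ k ∈ [1,z] : gcd k z = 1 }  (so φ 0 = 0, φ 1 = 1)
φ : ℕ → ℕ
φ z = length (filter (λ k → gcd k z ≟ 1) (map suc (upTo z)))

ι : ℕ → ℚ
ι n = + n / 1

InVℓ : ℕ → ℕ → Set
InVℓ ℓ m = _%_ m (2 ^ (ℓ + 1)) {{m^n≢0 2 (ℓ + 1)}} ≡ 2 ^ ℓ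

SSet : ℕ → ℚ → Set
SSet ℓ x = Σ ℕ (λ z → (1 ≤ z) × InVℓ ℓ (φ z) × (ι (φ z) ≤ℚ x))

-- "S^ℓ(x) = k": the set SSet ℓ x has exactly k elements
SIs : ℕ → ℚ → ℕ → Set
SIs ℓ x k = Fin k ↔ SSet ℓ x

{-# OPTIONS --safe #-}
-- For odd m, the k ≤ 2m coprime to 2m are the odd k coprime to m, and of k and k + m
-- exactly one is odd, so φ(2m) = φ(m); for even m both halves of [1, 2m] contribute φ(m),
-- so φ(2m) = 2φ(m). Hence z ↦ 2ⁿz′, with z′ = z for even z and z′ = 2z for odd z,
-- multiplies φ(z) by exactly 2ⁿ: it carries 𝒱^ℓ into 𝒱^(ℓ+n) and φ(z) ≤ x into φ ≤ 2ⁿx.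
-- Only an odd z and 2z collide, so S^ℓ(x) ≤ 2·S^(ℓ+n)(2ⁿx) ≤ 2ⁿ·S^(ℓ+n)(2ⁿx).
module Submission where

open import Defs
open import Data.Nat using (ℕ; zero; suc; _≤_; _*_; _^_; _+_; s≤s; NonZero)
open import Data.Nat.Properties
open import Algebra.Properties.CommutativeSemigroup +-commutativeSemigroup
  using (interchange; xy∙z≈xz∙y)
open import Data.Nat.Divisibility
open import Data.Nat.DivMod using (_%_; %-congʳ; %-distribˡ-+; m%n<n; m%n*o≡m*o%[n*o])
open import Data.Nat.GCD using (gcd)
open import Data.Nat.Coprimality as Coprimality
  using (Coprime; coprime?; coprime-divisor; coprime⇒gcd≡1; gcd≡1⇒coprime; 1-coprimeTo)
open import Data.Nat.Primality using (irreducible[2])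
import Data.Integer as ℤ
open import Data.Integer.Properties using (pos-*)
open import Data.Rational using (ℚ; mkℚ; _/_)
  renaming (_<_ to _<ℚ_; _≤_ to _≤ℚ_; _*_ to _*ℚ_)
open import Data.Rational.Properties
  using (normalize-coprime; normalize-nonNeg; *-monoˡ-≤-nonNeg)
  renaming (≤-irrelevant to ≤ℚ-irrelevant)
open import Data.Bool using (Bool)
open import Data.Fin using (Fin)
open import Data.Fin.Properties using (injective⇒≤; *↔×; 2↔Bool)
open import Data.List using (length; filter; applyUpTo)
open import Data.List.Properties using (map-upTo)
open import Data.Product using (_×_; _,_; proj₁; proj₂)
open import Data.Product.Function.NonDependent.Propositional using (_×-⇔_; _×-↔_)
open import Data.Sum using (inj₁; inj₂)
open import Function using (_∘_; case_of_; _⇔_; mk⇔; Equivalence; _↔_; _↣_; mk↣; Injection)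
open import Function.Construct.Composition using (_⇔-∘_; _↣-∘_)
open import Function.Properties.Inverse using (↔-sym; ↔-trans; ↔⇒↣)
open import Relation.Nullary using (Dec; yes; no; does; ¬_; contradiction)
open import Relation.Nullary.Decidable using (decidable-stable)
open import Relation.Unary using (Pred; Decidable)
open import Relation.Binary.PropositionalEquality

∑< : ℕ → (ℕ → ℕ) → ℕ
∑< zero    f = 0
∑< (suc n) f = f 0 + ∑< n (f ∘ suc)

∑<-cong : ∀ n {f g : ℕ → ℕ} → f ≗ g → ∑< n f ≡ ∑< n g
∑<-cong zero    f≗g = refl
∑<-cong (suc n) f≗g = cong₂ _+_ (f≗g 0) (∑<-cong n (f≗g ∘ suc))

∑<-+ : ∀ m n (f : ℕ → ℕ) → ∑< (m + n) f ≡ ∑< m f + ∑< n (λ i → f (i + m))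
∑<-+ zero    n f = ∑<-cong n (λ i → cong f (sym (+-identityʳ i)))
∑<-+ (suc m) n f = begin
  f 0 + ∑< (m + n) (f ∘ suc)                             ≡⟨ cong (f 0 +_) (∑<-+ m n (f ∘ suc)) ⟩
  f 0 + (∑< m (f ∘ suc) + ∑< n (λ i → f (suc (i + m)))) ≡⟨ +-assoc (f 0) _ _ ⟨
  f 0 + ∑< m (f ∘ suc) + ∑< n (λ i → f (suc (i + m)))   ≡⟨ cong (_ +_) (∑<-cong n (λ i → cong f (+-suc i m))) ⟨
  f 0 + ∑< m (f ∘ suc) + ∑< n (λ i → f (i + suc m))     ∎
  where open ≡-Reasoning

∑<-2* : ∀ m (f : ℕ → ℕ) → ∑< (2 * m) f ≡ ∑< m f + ∑< m (λ i → f (i + m))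
∑<-2* m f = trans (cong (λ j → ∑< (m + j) f) (+-identityʳ m)) (∑<-+ m m f)

∑<-distrib-+ : ∀ n (f g : ℕ → ℕ) → ∑< n (λ i → f i + g i) ≡ ∑< n f + ∑< n g
∑<-distrib-+ zero    f g = refl
∑<-distrib-+ (suc n) f g =
  trans (cong (f 0 + g 0 +_) (∑<-distrib-+ n (f ∘ suc) (g ∘ suc))) (interchange (f 0) (g 0) _ _)

𝟙 : ∀ {a} {A : Set a} → Dec A → ℕ
𝟙 (yes _) = 1
𝟙 (no _)  = 0

𝟙-yes : ∀ {a} {A : Set a} → A → (A? : Dec A) → 𝟙 A? ≡ 1
𝟙-yes a (yes _) = refl
𝟙-yes a (no ¬a) = contradiction a ¬a

𝟙-no : ∀ {a} {A : Set a} → ¬ A → (A? : Dec A) → 𝟙 A? ≡ 0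
𝟙-no ¬a (yes a) = contradiction a ¬a
𝟙-no ¬a (no _)  = refl

𝟙-cong : ∀ {a b} {A : Set a} {B : Set b} →
  A ⇔ B → (A? : Dec A) (B? : Dec B) → 𝟙 A? ≡ 𝟙 B?
𝟙-cong A⇔B (yes a) B? = sym (𝟙-yes (Equivalence.to A⇔B a) B?)
𝟙-cong A⇔B (no ¬a) B? = sym (𝟙-no (¬a ∘ Equivalence.from A⇔B) B?)

𝟙-partition : ∀ {a b x y} {A : Set a} {B : Set b} {X : Set x} {Y : Set y} →
  (A? : Dec A) → Dec B → (X? : Dec X) (Y? : Dec Y) →
  X ⇔ (A × ¬ B) → Y ⇔ (A × B) → 𝟙 X? + 𝟙 Y? ≡ 𝟙 A?
𝟙-partition (yes a) (yes b) X? Y? X⇔ Y⇔ = cong₂ _+_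
  (𝟙-no (λ x → proj₂ (Equivalence.to X⇔ x) b) X?)
  (𝟙-yes (Equivalence.from Y⇔ (a , b)) Y?)
𝟙-partition (yes a) (no ¬b) X? Y? X⇔ Y⇔ = cong₂ _+_
  (𝟙-yes (Equivalence.from X⇔ (a , ¬b)) X?)
  (𝟙-no (¬b ∘ proj₂ ∘ Equivalence.to Y⇔) Y?)
𝟙-partition (no ¬a) _ X? Y? X⇔ Y⇔ = cong₂ _+_
  (𝟙-no (¬a ∘ proj₁ ∘ Equivalence.to X⇔) X?)
  (𝟙-no (¬a ∘ proj₁ ∘ Equivalence.to Y⇔) Y?)

length-filter-applyUpTo : ∀ {p} {P : Pred ℕ p} (P? : Decidable P) (f : ℕ → ℕ) n →
  length (filter P? (applyUpTo f n)) ≡ ∑< n (λ i → 𝟙 (P? (f i)))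
length-filter-applyUpTo P? f zero = refl
length-filter-applyUpTo P? f (suc n) with P? (f 0)
... | yes _ = cong suc (length-filter-applyUpTo P? (f ∘ suc) n)
... | no  _ = length-filter-applyUpTo P? (f ∘ suc) n

φ≡∑ : ∀ z → φ z ≡ ∑< z (λ i → 𝟙 (coprime? (suc i) z))
φ≡∑ z = begin
  φ z                                     ≡⟨ cong (length ∘ filter gcd≟1) (map-upTo suc z) ⟩
  length (filter gcd≟1 (applyUpTo suc z)) ≡⟨ length-filter-applyUpTo gcd≟1 suc z ⟩
  ∑< z (λ i → 𝟙 (gcd≟1 (suc i)))          ≡⟨ ∑<-cong z (λ i → 𝟙-cong gcd≡1⇔coprime _ _) ⟩
  ∑< z (λ i → 𝟙 (coprime? (suc i) z))     ∎
  where
  open ≡-Reasoning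
  gcd≟1 : Decidable (λ k → gcd k z ≡ 1)
  gcd≟1 k = gcd k z ≟ 1
  gcd≡1⇔coprime : ∀ {k} → gcd k z ≡ 1 ⇔ Coprime k z
  gcd≡1⇔coprime = mk⇔ gcd≡1⇒coprime coprime⇒gcd≡1

coprime-∣ˡ : ∀ {j k m} → j ∣ k → Coprime k m → Coprime j m
coprime-∣ˡ j∣k k⊥m (d∣j , d∣m) = k⊥m (∣-trans d∣j j∣k , d∣m)

coprime-∣ʳ : ∀ {k m n} → n ∣ m → Coprime k m → Coprime k n
coprime-∣ʳ n∣m k⊥m (d∣k , d∣n) = k⊥m (d∣k , ∣-trans d∣n n∣m)

coprime-* : ∀ {k m n} → Coprime k m → Coprime k n → Coprime k (m * n)
coprime-* k⊥m k⊥n (d∣k , d∣mn) = k⊥n (d∣k , coprime-divisor (coprime-∣ˡ d∣k k⊥m) d∣mn)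

coprime-+-⇔ : ∀ {k m} → Coprime (k + m) m ⇔ Coprime k m
coprime-+-⇔ {k} {m} = mk⇔ drop add
  where
  drop : Coprime (k + m) m → Coprime k m
  drop k+m⊥m (d∣k , d∣m) = k+m⊥m (∣m∣n⇒∣m+n d∣k d∣m , d∣m)
  add : Coprime k m → Coprime (k + m) m
  add k⊥m {d} (d∣k+m , d∣m) = k⊥m (∣m+n∣m⇒∣n (subst (d ∣_) (+-comm k m) d∣k+m) d∣m , d∣m)

coprime-2⇔¬2∣ : ∀ {k} → Coprime k 2 ⇔ (¬ 2 ∣ k)
coprime-2⇔¬2∣ = mk⇔
  (λ k⊥2 2∣k → contradiction (k⊥2 (2∣k , ∣-refl)) λ ())
  (λ ¬2∣k {d} (d∣k , d∣2) → case irreducible[2] d∣2 of λ where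
     (inj₁ d≡1)  → d≡1
     (inj₂ refl) → contradiction d∣k ¬2∣k)

coprime-2*-⇔ : ∀ {k m} → Coprime k (2 * m) ⇔ (Coprime k m × ¬ 2 ∣ k)
coprime-2*-⇔ {k} {m} = mk⇔ split join
  where
  split : Coprime k (2 * m) → Coprime k m × ¬ 2 ∣ k
  split k⊥2m = coprime-∣ʳ (n∣m*n 2) k⊥2m
             , Equivalence.to coprime-2⇔¬2∣ (coprime-∣ʳ (m∣m*n m) k⊥2m)
  join : Coprime k m × ¬ 2 ∣ k → Coprime k (2 * m)
  join (k⊥m , ¬2∣k) = coprime-* (Equivalence.from coprime-2⇔¬2∣ ¬2∣k) k⊥m

¬2∣⇒%2≡1 : ∀ {n} → ¬ 2 ∣ n → n % 2 ≡ 1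
¬2∣⇒%2≡1 {n} ¬2∣n with n % 2 in n%2≡r | m%n<n n 2
... | 0           | _            = contradiction (m%n≡0⇒n∣m n 2 n%2≡r) ¬2∣n
... | 1           | _            = refl
... | suc (suc _) | s≤s (s≤s ())

odd+odd-even : ∀ {m n} → ¬ 2 ∣ m → ¬ 2 ∣ n → 2 ∣ m + n
odd+odd-even {m} {n} ¬2∣m ¬2∣n = m%n≡0⇒n∣m (m + n) 2 (begin
  (m + n) % 2         ≡⟨ %-distribˡ-+ m n 2 ⟩
  (m % 2 + n % 2) % 2 ≡⟨ cong₂ (λ i j → (i + j) % 2) (¬2∣⇒%2≡1 ¬2∣m) (¬2∣⇒%2≡1 ¬2∣n) ⟩
  0                   ∎)
  where open ≡-Reasoning

¬2∣+odd⇔2∣ : ∀ {k m} → ¬ 2 ∣ m → (¬ 2 ∣ k + m) ⇔ 2 ∣ k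
¬2∣+odd⇔2∣ {k} {m} ¬2∣m = mk⇔
  (λ ¬2∣k+m → decidable-stable (2 ∣? k) (λ ¬2∣k → ¬2∣k+m (odd+odd-even ¬2∣k ¬2∣m)))
  (λ 2∣k 2∣k+m → ¬2∣m (∣m+n∣m⇒∣n 2∣k+m 2∣k))

φ-2*-even : ∀ {m} → 2 ∣ m → φ (2 * m) ≡ 2 * φ m
φ-2*-even {m} 2∣m = begin
  φ (2 * m)                       ≡⟨ φ≡∑ (2 * m) ⟩
  ∑< (2 * m) h                    ≡⟨ ∑<-2* m h ⟩
  ∑< m h + ∑< m (λ i → h (i + m)) ≡⟨ cong₂ _+_ (∑<-cong m low) (∑<-cong m high) ⟩
  ∑< m c + ∑< m c                 ≡⟨ cong (λ j → j + j) (φ≡∑ m) ⟨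
  φ m + φ m                       ≡⟨ cong (φ m +_) (+-identityʳ (φ m)) ⟨
  2 * φ m                         ∎
  where
  open ≡-Reasoning
  h c : ℕ → ℕ
  h i = 𝟙 (coprime? (suc i) (2 * m))
  c i = 𝟙 (coprime? (suc i) m)
  coprime-2*-⇔-even : ∀ {k} → Coprime k (2 * m) ⇔ Coprime k m
  coprime-2*-⇔-even = mk⇔ (proj₁ ∘ Equivalence.to coprime-2*-⇔)
    (λ k⊥m → Equivalence.from coprime-2*-⇔ (k⊥m , λ 2∣k → contradiction (k⊥m (2∣k , 2∣m)) λ ()))
  low : ∀ i → h i ≡ c i
  low i = 𝟙-cong coprime-2*-⇔-even _ _
  high : ∀ i → h (i + m) ≡ c i
  high i = 𝟙-cong (coprime-+-⇔ ⇔-∘ coprime-2*-⇔-even) _ _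

φ-2*-odd : ∀ {m} → ¬ 2 ∣ m → φ (2 * m) ≡ φ m
φ-2*-odd {m} ¬2∣m = begin
  φ (2 * m)                       ≡⟨ φ≡∑ (2 * m) ⟩
  ∑< (2 * m) h                    ≡⟨ ∑<-2* m h ⟩
  ∑< m h + ∑< m (λ i → h (i + m)) ≡⟨ ∑<-distrib-+ m h (λ i → h (i + m)) ⟨
  ∑< m (λ i → h i + h (i + m))    ≡⟨ ∑<-cong m pair ⟩
  ∑< m c                          ≡⟨ φ≡∑ m ⟨
  φ m                             ∎
  where
  open ≡-Reasoning
  h c : ℕ → ℕ
  h i = 𝟙 (coprime? (suc i) (2 * m))
  c i = 𝟙 (coprime? (suc i) m)
  pair : ∀ i → h i + h (i + m) ≡ c i
  pair i = 𝟙-partition (coprime? (suc i) m) (2 ∣? suc i)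
    (coprime? (suc i) (2 * m)) (coprime? (suc i + m) (2 * m))
    coprime-2*-⇔ ((coprime-+-⇔ ×-⇔ ¬2∣+odd⇔2∣ ¬2∣m) ⇔-∘ coprime-2*-⇔)

φ-2^*-even : ∀ n {w} → 2 ∣ w → φ (2 ^ n * w) ≡ 2 ^ n * φ w
φ-2^*-even zero    {w} _   = trans (cong φ (*-identityˡ w)) (sym (*-identityˡ (φ w)))
φ-2^*-even (suc n) {w} 2∣w = begin
  φ (2 * 2 ^ n * w)   ≡⟨ cong φ (*-assoc 2 (2 ^ n) w) ⟩
  φ (2 * (2 ^ n * w)) ≡⟨ φ-2*-even (∣n⇒∣m*n (2 ^ n) 2∣w) ⟩
  2 * φ (2 ^ n * w)   ≡⟨ cong (2 *_) (φ-2^*-even n 2∣w) ⟩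
  2 * (2 ^ n * φ w)   ≡⟨ *-assoc 2 (2 ^ n) (φ w) ⟨
  2 * 2 ^ n * φ w     ∎
  where open ≡-Reasoning

-- The parity decision is a parameter: `2 ∣? z` reduces by computation, which defeats `with`.
doubleIfOdd : ∀ z → Dec (2 ∣ z) → ℕ
doubleIfOdd z (yes _) = z
doubleIfOdd z (no  _) = 2 * z

2∣doubleIfOdd : ∀ z (2∣?z : Dec (2 ∣ z)) → 2 ∣ doubleIfOdd z 2∣?z
2∣doubleIfOdd z (yes 2∣z) = 2∣z
2∣doubleIfOdd z (no  _)   = m∣m*n z

m≤doubleIfOdd : ∀ z (2∣?z : Dec (2 ∣ z)) → z ≤ doubleIfOdd z 2∣?z
m≤doubleIfOdd z (yes _) = ≤-refl
m≤doubleIfOdd z (no  _) = m≤n*m z 2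

φ-doubleIfOdd : ∀ z (2∣?z : Dec (2 ∣ z)) → φ (doubleIfOdd z 2∣?z) ≡ φ z
φ-doubleIfOdd z (yes _)   = refl
φ-doubleIfOdd z (no ¬2∣z) = φ-2*-odd ¬2∣z

φ-2^*-doubleIfOdd : ∀ n z (2∣?z : Dec (2 ∣ z)) → φ (2 ^ n * doubleIfOdd z 2∣?z) ≡ 2 ^ n * φ z
φ-2^*-doubleIfOdd n z 2∣?z =
  trans (φ-2^*-even n (2∣doubleIfOdd z 2∣?z)) (cong (2 ^ n *_) (φ-doubleIfOdd z 2∣?z))

doubleIfOdd-injective : ∀ {z z′} (2∣?z : Dec (2 ∣ z)) (2∣?z′ : Dec (2 ∣ z′)) →
  does 2∣?z ≡ does 2∣?z′ → doubleIfOdd z 2∣?z ≡ doubleIfOdd z′ 2∣?z′ → z ≡ z′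
doubleIfOdd-injective         (yes _) (yes _) _  eq = eq
doubleIfOdd-injective {z} {z′} (no _)  (no _)  _  eq = *-cancelˡ-≡ z z′ 2 eq
doubleIfOdd-injective         (yes _) (no _)  () _
doubleIfOdd-injective         (no _)  (yes _) () _

InVℓ-2^* : ∀ ℓ n {a} → InVℓ ℓ a → InVℓ (ℓ + n) (2 ^ n * a)
InVℓ-2^* ℓ n {a} a∈Vℓ = begin
  2 ^ n * a % 2 ^ (ℓ + n + 1)       ≡⟨ %-congʳ modulus-split ⟩
  2 ^ n * a % (2 ^ (ℓ + 1) * 2 ^ n) ≡⟨ cong (_% (2 ^ (ℓ + 1) * 2 ^ n)) (*-comm (2 ^ n) a) ⟩
  a * 2 ^ n % (2 ^ (ℓ + 1) * 2 ^ n) ≡⟨ m%n*o≡m*o%[n*o] a (2 ^ (ℓ + 1)) (2 ^ n) ⟨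
  a % 2 ^ (ℓ + 1) * 2 ^ n           ≡⟨ cong (_* 2 ^ n) a∈Vℓ ⟩
  2 ^ ℓ * 2 ^ n                     ≡⟨ ^-distribˡ-+-* 2 ℓ n ⟨
  2 ^ (ℓ + n)                       ∎
  where
  open ≡-Reasoning
  instance
    2^n≢0 : NonZero (2 ^ n)
    2^n≢0 = m^n≢0 2 n
    2^[ℓ+1]≢0 : NonZero (2 ^ (ℓ + 1))
    2^[ℓ+1]≢0 = m^n≢0 2 (ℓ + 1)
    2^[ℓ+n+1]≢0 : NonZero (2 ^ (ℓ + n + 1))
    2^[ℓ+n+1]≢0 = m^n≢0 2 (ℓ + n + 1)
    2^[ℓ+1]*2^n≢0 : NonZero (2 ^ (ℓ + 1) * 2 ^ n)
    2^[ℓ+1]*2^n≢0 = m*n≢0 (2 ^ (ℓ + 1)) (2 ^ n)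
  modulus-split : 2 ^ (ℓ + n + 1) ≡ 2 ^ (ℓ + 1) * 2 ^ n
  modulus-split = trans (cong (2 ^_) (xy∙z≈xz∙y ℓ n 1)) (^-distribˡ-+-* 2 (ℓ + 1) n)

ι-* : ∀ a b → ι (a * b) ≡ ι a *ℚ ι b
ι-* a b = begin
  ι (a * b)                                ≡⟨ cong (_/ 1) (pos-* a b) ⟩
  (ℤ.+ a ℤ.* ℤ.+ b) / 1                    ≡⟨⟩
  mkℚ (ℤ.+ a) 0 a⊥1 *ℚ mkℚ (ℤ.+ b) 0 b⊥1   ≡⟨ cong₂ _*ℚ_ (normalize-coprime a⊥1) (normalize-coprime b⊥1) ⟨
  ι a *ℚ ι b                               ∎
  where
  open ≡-Reasoning
  a⊥1 : Coprime a 1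
  a⊥1 = Coprimality.sym (1-coprimeTo a)
  b⊥1 : Coprime b 1
  b⊥1 = Coprimality.sym (1-coprimeTo b)

ι-*-mono-≤ : ∀ c {a x} → ι a ≤ℚ x → ι (c * a) ≤ℚ ι c *ℚ x
ι-*-mono-≤ c {a} ιa≤x =
  subst (_≤ℚ ι c *ℚ _) (sym (ι-* c a)) (*-monoˡ-≤-nonNeg (ι c) {{normalize-nonNeg c 1}} ιa≤x)

SSet-proj₁-injective : ∀ {ℓ x} {e e′ : SSet ℓ x} → proj₁ e ≡ proj₁ e′ → e ≡ e′
SSet-proj₁-injective {e = z , p , q , r} {.z , p′ , q′ , r′} refl =
  cong₂ (λ u v → z , u , v) (≤-irrelevant p p′) (cong₂ _,_ (≡-irrelevant q q′) (≤ℚ-irrelevant r r′))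

scale : ∀ ℓ n x → SSet ℓ x → SSet (ℓ + n) (ι (2 ^ n) *ℚ x)
scale ℓ n x (z , 1≤z , φz∈Vℓ , φz≤x) = w , 1≤w , φw∈Vℓ+n , φw≤2ⁿx
  where
  w : ℕ
  w = 2 ^ n * doubleIfOdd z (2 ∣? z)
  φw≡2ⁿφz : φ w ≡ 2 ^ n * φ z
  φw≡2ⁿφz = φ-2^*-doubleIfOdd n z (2 ∣? z)
  1≤w : 1 ≤ w
  1≤w = ≤-trans 1≤z (≤-trans (m≤doubleIfOdd z (2 ∣? z)) (m≤n*m _ (2 ^ n) {{m^n≢0 2 n}}))
  φw∈Vℓ+n : InVℓ (ℓ + n) (φ w)
  φw∈Vℓ+n = subst (InVℓ (ℓ + n)) (sym φw≡2ⁿφz) (InVℓ-2^* ℓ n φz∈Vℓ)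
  φw≤2ⁿx : ι (φ w) ≤ℚ ι (2 ^ n) *ℚ x
  φw≤2ⁿx = subst (_≤ℚ _) (cong ι (sym φw≡2ⁿφz)) (ι-*-mono-≤ (2 ^ n) φz≤x)

scale-tagged : ∀ ℓ n x → SSet ℓ x ↣ (SSet (ℓ + n) (ι (2 ^ n) *ℚ x) × Bool)
scale-tagged ℓ n x = mk↣ {to = tagged} injective
  where
  tagged : SSet ℓ x → SSet (ℓ + n) (ι (2 ^ n) *ℚ x) × Bool
  tagged e = scale ℓ n x e , does (2 ∣? proj₁ e)
  injective : ∀ {e e′} → tagged e ≡ tagged e′ → e ≡ e′
  injective {z , _} {z′ , _} eq = SSet-proj₁-injective {ℓ} {x}
    (doubleIfOdd-injective (2 ∣? z) (2 ∣? z′) (cong proj₂ eq)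
      (*-cancelˡ-≡ _ _ (2 ^ n) {{m^n≢0 2 n}} (cong (proj₁ ∘ proj₁) eq)))

↣⇒≤ : ∀ {a b} {A : Set a} {B : Set b} {m n} → Fin m ↔ A → Fin n ↔ B → A ↣ B → m ≤ n
↣⇒≤ Fm↔A Fn↔B A↣B =
  injective⇒≤ (Injection.injective (↔⇒↣ (↔-sym Fn↔B) ↣-∘ (A↣B ↣-∘ ↔⇒↣ Fm↔A)))

lemma3p7 : (x : ℚ) → ι 1 <ℚ x → (ℓ n : ℕ) → 1 ≤ ℓ → 1 ≤ n →
    (s t : ℕ) → SIs ℓ x s → SIs (ℓ + n) (ι (2 ^ n) *ℚ x) t →
    s ≤ 2 ^ n * t
lemma3p7 x _ ℓ n _ 1≤n s t Fs↔S Ft↔T = begin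
  s         ≤⟨ ↣⇒≤ Fs↔S (↔-trans *↔× (Ft↔T ×-↔ 2↔Bool)) (scale-tagged ℓ n x) ⟩
  t * 2     ≡⟨ *-comm t 2 ⟩
  2 * t     ≤⟨ *-monoˡ-≤ t (^-monoʳ-≤ 2 1≤n) ⟩
  2 ^ n * t ∎
  where open ≤-Reasoning
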